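{- Let $m,n\in\mathbb{N}$ with $n>1$ and $m=\omega(n)$. Then the following two statements are equivalent: (1) there exists $a\in\mathbb{Z}$ such that for every $q\in\{1,\dots,m\}$ there is $i\in\{2,\dots,n\}$ with $a+q\equiv 0\pmod{p_i}$; (2) there exist $a_i\in\{1,\dots,p_i-1\}$, $i=2,\dots,n$, such that for every $q\in\{1,\dots,m\}$ there is $i\in\{2,\dots,n\}$ with $q\equiv a_i\pmod{p_i}$.
   Context: Let $p_1=2,p_2=3,p_3=5,\dots$ be the primes in increasing order. For $n>1$, $\omega(n)$ denotes the greatest length of a sequence of consecutive integers each of which is divisible by at least one of the primes $p_2,\dots,p_n$. -}

module Defs where

open import Data.Nat using (ℕ; zero; suc; _+_; _≤_; _<_; _!)

open import Data.Nat.Primality using (Prime; prime?)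
open import Data.Integer as ℤ using (ℤ; +_)
open import Data.Integer.Divisibility as ℤD using ()
open import Data.Product using (Σ; _×_; ∃)
open import Relation.Nullary using (yes; no)

searchPrime : ℕ → ℕ → ℕ
searchPrime zero    k = 0
searchPrime (suc f) k with prime? k
... | yes _ = k
... | no  _ = searchPrime f (suc k)

-- Least prime > k (Euclid: such a prime lies in (k, k! + 1]).
nextPrime : ℕ → ℕ
nextPrime k = searchPrime ((k !) + 1) (suc k)

-- The primes in increasing order, 1-indexed: p 1 = 2, p 2 = 3, p 3 = 5, ...
-- (p 0 = 0 is a junk value, never used.)
p : ℕ → ℕ
p zero          = 0
p (suc zero)    = 2
p (suc (suc i)) = nextPrime (p (suc i))

Covered : ℕ → ℤ → Set
Covered n x = ∃ λ i → 2 ≤ i × i ≤ n × (+ (p i)) ℤD.∣ x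

Run : ℕ → ℤ → ℕ → Set
Run n a len = ∀ q → 1 ≤ q → q ≤ len → Covered n (a ℤ.+ + q)

-- m = ω(n): m is the greatest length of a run of consecutive covered integers
IsOmega : ℕ → ℕ → Set
IsOmega n m = (∃ λ a → Run n a m) × (∀ a len → Run n a len → len ≤ m)

{-# OPTIONS --safe #-}
-- If a+1, …, a+m are all covered, then a itself is not, since otherwise a, …, a+m
-- would be a longer run.  Hence a_i := (−a) mod p_i lies in {1, …, p_i − 1}, and
-- p_i ∣ a + q exactly when q ≡ a_i (mod p_i).  Conversely, the Chinese remainder
-- theorem gives a ≡ −a_i (mod p_i) for all i ≤ n, and then q ≡ a_i (mod p_i)
-- yields p_i ∣ a + q.
module Submission where

open import Defs
open import Data.Nat
  using (ℕ; zero; suc; _+_; _*_; _!; _≤_; _<_; _≤?_; z≤n; s≤s; NonZero; >-nonZero; >-nonZero⁻¹)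
open import Data.Nat.Properties
open import Data.Nat.Divisibility
  using (_∣_; divides; ∣-trans; n∣m*n; m∣m*n; ∣1⇒≡1; ∣⇒≤; ∣m+n∣m⇒∣n; m≤n⇒m!∣n!)
open import Data.Nat.Primality
  using (Prime; prime?; prime[2]; ¬prime[1]; prime⇒nonZero; prime⇒irreducible; euclidsLemma)
open import Data.Nat.Primality.Factorisation using (factorise)
open import Data.Nat.Coprimality as Coprimality using (Coprime; coprime-Bézout)
open import Data.Nat.GCD using (module Bézout)
open import Data.Nat.ListAction using (product)
open import Data.List using ([]; _∷_)
open import Data.List.Relation.Unary.All using (_∷_)
open import Data.Integer as ℤ using (ℤ; +_)
import Data.Integer.Properties as ℤ
open import Data.Integer.DivMod using (_%ℕ_; _/ℕ_; n%ℕd<d; a≡a%ℕn+[a/ℕn]*n)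
open import Data.Integer.Divisibility as ℤD using ()
open import Data.Integer.Divisibility.Signed as ℤ∣ using () renaming (_∣_ to _∣ℤ_)
open import Data.Integer.Tactic.RingSolver using (solve-∀)
open import Data.Product using (_×_; ∃; _,_; proj₁; proj₂)
open import Data.Sum using (inj₁; inj₂)
open import Relation.Nullary using (¬_; yes; no; contradiction)
open import Relation.Binary.PropositionalEquality
open import Function.Bundles using (_⇔_; mk⇔)

searchPrime-prime : ∀ f k {r} → Prime r → k ≤ r → r < k + f →
                    Prime (searchPrime f k) × k ≤ searchPrime f k
searchPrime-prime zero k pr k≤r r<k+0 =
  contradiction (subst (k <_) (+-identityʳ k) (≤-<-trans k≤r r<k+0)) (n≮n k)
searchPrime-prime (suc f) k {r} pr k≤r r<k+1+f with prime? k
... | yes pk  = pk , ≤-refl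
... | no  ¬pk with m≤n⇒m<n∨m≡n k≤r
...   | inj₂ refl = contradiction pr ¬pk
...   | inj₁ k<r  =
  let pr′ , 1+k≤ = searchPrime-prime f (suc k) pr k<r (subst (r <_) (+-suc k f) r<k+1+f)
  in  pr′ , ≤-trans (n≤1+n k) 1+k≤

∃-prime-∣ : ∀ n → 2 ≤ n → ∃ λ r → Prime r × r ∣ n
∃-prime-∣ n 2≤n with factorise n ⦃ >-nonZero (≤-trans (s≤s z≤n) 2≤n) ⦄
... | record { factors = [] ; isFactorisation = n≡1 } =
  contradiction (subst (2 ≤_) n≡1 2≤n) λ { (s≤s ()) }
... | record { factors = r ∷ rs ; isFactorisation = n≡r*rs ; factorsPrime = pr ∷ _ } =
  r , pr , divides (product rs) (trans n≡r*rs (*-comm r (product rs)))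

prime∣n!+1⇒n< : ∀ {r} n → Prime r → r ∣ n ! + 1 → n < r
prime∣n!+1⇒n< {suc r} n pr r∣n!+1 with suc r ≤? n
... | no  r≰n = ≰⇒> r≰n
... | yes r≤n = contradiction (subst Prime (∣1⇒≡1 (∣m+n∣m⇒∣n r∣n!+1 r∣n!)) pr) ¬prime[1]
  where
  r∣n! : suc r ∣ n !
  r∣n! = ∣-trans (divides (r !) (*-comm (suc r) (r !))) (m≤n⇒m!∣n! r≤n)

-- Euclid: any prime divisor of n! + 1 lies in (n, n! + 1], inside the search window.
nextPrime-spec : ∀ n → Prime (nextPrime n) × n < nextPrime n
nextPrime-spec n =
  let r , pr , r∣n!+1 = ∃-prime-∣ (n ! + 1) (+-monoˡ-≤ 1 (>-nonZero⁻¹ (n !) ⦃ n !≢0 ⦄))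
  in  searchPrime-prime (n ! + 1) (suc n) pr (prime∣n!+1⇒n< n pr r∣n!+1)
        (s≤s (≤-trans (∣⇒≤ (subst (r ∣_) (+-comm (n !) 1) r∣n!+1))
                      (≤-trans (≤-reflexive (+-comm 1 (n !))) (m≤n+m (n ! + 1) n))))

p-prime : ∀ i → Prime (p (suc i))
p-prime zero    = prime[2]
p-prime (suc i) = proj₁ (nextPrime-spec (p (suc i)))

p-nonZero : ∀ i → NonZero (p (suc i))
p-nonZero i = prime⇒nonZero (p-prime i)

p-strictMono : ∀ {i j} → i < j → p (suc i) < p (suc j)
p-strictMono {i} {suc j} (s≤s i≤j) with m≤n⇒m<n∨m≡n i≤j
... | inj₂ refl = proj₂ (nextPrime-spec (p (suc i)))
... | inj₁ i<j  = <-trans (p-strictMono i<j) (proj₂ (nextPrime-spec (p (suc j))))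

∏ : (ℕ → ℕ) → ℕ → ℕ
∏ d zero    = 1
∏ d (suc k) = ∏ d k * d (suc k)

∣∏ : ∀ d {i k} → 1 ≤ i → i ≤ k → d i ∣ ∏ d k
∣∏ d {k = zero}  (s≤s _) ()
∣∏ d {i} {suc k} 1≤i i≤1+k with m≤n⇒m<n∨m≡n i≤1+k
... | inj₂ refl      = n∣m*n (∏ d k)
... | inj₁ (s≤s i≤k) = ∣-trans (∣∏ d 1≤i i≤k) (m∣m*n (d (suc k)))

coprime⇒∃[≡0,≡1] : ∀ {m n} → Coprime m n → ∃ λ e → + m ∣ℤ e × + n ∣ℤ e ℤ.- + 1
coprime⇒∃[≡0,≡1] {m} {n} m⊥n with coprime-Bézout m⊥n
... | Bézout.+- x y 1+yn≡xm =
  + (x * m) , ℤ∣.∣ᵤ⇒∣ (n∣m*n x) ,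
  subst (λ t → + n ∣ℤ + t ℤ.- + 1) 1+yn≡xm (ℤ∣.∣ᵤ⇒∣ (n∣m*n y))
... | Bézout.-+ x y 1+xm≡yn =
  ℤ.- + (x * m) , ℤ∣.∣m⇒∣-m (ℤ∣.∣ᵤ⇒∣ (n∣m*n x)) ,
  subst (+ n ∣ℤ_) (sym e-1≡-yn) (ℤ∣.∣m⇒∣-m (ℤ∣.∣ᵤ⇒∣ (n∣m*n y)))
  where
  -k-1≡-[1+k] : ∀ k → ℤ.- k ℤ.- + 1 ≡ ℤ.- (+ 1 ℤ.+ k)
  -k-1≡-[1+k] = solve-∀
  e-1≡-yn : ℤ.- + (x * m) ℤ.- + 1 ≡ ℤ.- + (y * n)
  e-1≡-yn = trans (-k-1≡-[1+k] (+ (x * m))) (cong (λ t → ℤ.- + t) 1+xm≡yn)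

coprime⇒∃-solution : ∀ {m n} → Coprime m n → ∀ x y →
                     ∃ λ z → + m ∣ℤ z ℤ.- x × + n ∣ℤ z ℤ.- y
coprime⇒∃-solution {m} {n} m⊥n x y =
  let e , m∣e , n∣e-1 = coprime⇒∃[≡0,≡1] m⊥n
  in  x ℤ.+ (y ℤ.- x) ℤ.* e ,
      subst (+ m ∣ℤ_) (sym (z-x≡ x y e)) (ℤ∣.∣n⇒∣m*n (y ℤ.- x) m∣e) ,
      subst (+ n ∣ℤ_) (sym (z-y≡ x y e)) (ℤ∣.∣n⇒∣m*n (y ℤ.- x) n∣e-1)
  where
  z-x≡ : ∀ x y e → x ℤ.+ (y ℤ.- x) ℤ.* e ℤ.- x ≡ (y ℤ.- x) ℤ.* e
  z-x≡ = solve-∀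
  z-y≡ : ∀ x y e → x ℤ.+ (y ℤ.- x) ℤ.* e ℤ.- y ≡ (y ℤ.- x) ℤ.* (e ℤ.- + 1)
  z-y≡ = solve-∀

Solves : (ℕ → ℕ) → (ℕ → ℤ) → ℕ → ℤ → Set
Solves d c k a = ∀ i → 1 ≤ i → i ≤ k → + d i ∣ℤ a ℤ.- c i

Solves-extend : ∀ {d c k a z} → Solves d c k a →
                + ∏ d k ∣ℤ z ℤ.- a → + d (suc k) ∣ℤ z ℤ.- c (suc k) →
                Solves d c (suc k) z
Solves-extend {d} {c} {k} {a} {z} a-solves z≡a z≡c[1+k] i 1≤i i≤1+k
  with m≤n⇒m<n∨m≡n i≤1+k
... | inj₂ refl      = z≡c[1+k]
... | inj₁ (s≤s i≤k) =
  subst (+ d i ∣ℤ_) (ℤ.+-minus-telescope z a (c i))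
    (ℤ∣.∣m∣n⇒∣m+n (ℤ∣.∣-trans d∣∏ z≡a) (a-solves i 1≤i i≤k))
  where
  d∣∏ : + d i ∣ℤ + ∏ d k
  d∣∏ = ℤ∣.∣ᵤ⇒∣ (∣∏ d 1≤i i≤k)

chineseRemainder : ∀ d → (∀ k → Coprime (∏ d k) (d (suc k))) → ∀ c k → ∃ (Solves d c k)
chineseRemainder d coprime c zero    = + 0 , λ _ 1≤i i≤0 → contradiction (≤-trans 1≤i i≤0) λ ()
chineseRemainder d coprime c (suc k) =
  let a , a-solves       = chineseRemainder d coprime c k
      z , z≡a , z≡c[1+k] = coprime⇒∃-solution (coprime k) a (c (suc k))
  in  z , Solves-extend {d} {c} {k} {a} {z} a-solves z≡a z≡c[1+k]

prime∤⇒coprime : ∀ {q n} → Prime q → ¬ q ∣ n → Coprime q n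
prime∤⇒coprime pq q∤n (d∣q , d∣n) with prime⇒irreducible pq d∣q
... | inj₁ d≡1 = d≡1
... | inj₂ refl = contradiction d∣n q∤n

p∤∏p : ∀ {k j} → k ≤ j → ¬ p (suc j) ∣ ∏ p k
p∤∏p {zero}  {j} _ p∣1 = ¬prime[1] (subst Prime (∣1⇒≡1 p∣1) (p-prime j))
p∤∏p {suc k} {j} k<j p∣∏p*p with euclidsLemma (∏ p k) (p (suc k)) (p-prime j) p∣∏p*p
... | inj₁ p∣∏p = p∤∏p (<⇒≤ k<j) p∣∏p
... | inj₂ p∣p  = <⇒≱ (p-strictMono k<j) (∣⇒≤ ⦃ p-nonZero k ⦄ p∣p)

∏p-coprime-p : ∀ k → Coprime (∏ p k) (p (suc k))
∏p-coprime-p k = Coprimality.sym (prime∤⇒coprime (p-prime k) (p∤∏p {k} ≤-refl))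

CoveredByResidues : ℕ → (ℕ → ℕ) → ℕ → Set
CoveredByResidues n r len =
  ∀ q → 1 ≤ q → q ≤ len → ∃ λ i → 2 ≤ i × i ≤ n × + p i ℤD.∣ + q ℤ.- + r i

Run-extendˡ : ∀ {n a len} → Covered n a → Run n a len → Run n (a ℤ.- + 1) (suc len)
Run-extendˡ {n} {a} cov run (suc zero)    _ _ =
  subst (Covered n) (sym (a-1+1≡a a)) cov
  where
  a-1+1≡a : ∀ a → a ℤ.- + 1 ℤ.+ + 1 ≡ a
  a-1+1≡a = solve-∀
Run-extendˡ {n} {a} cov run (suc (suc q)) _ (s≤s q≤len) =
  subst (Covered n) (sym (a-1+[1+x]≡a+x a (+ suc q))) (run (suc q) (s≤s z≤n) q≤len)
  where
  a-1+[1+x]≡a+x : ∀ a x → a ℤ.- + 1 ℤ.+ (+ 1 ℤ.+ x) ≡ a ℤ.+ x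
  a-1+[1+x]≡a+x = solve-∀

maximalRun⇒¬Covered : ∀ {n m a} → IsOmega n m → Run n a m → ¬ Covered n a
maximalRun⇒¬Covered {n} {m} {a} (_ , maximal) run cov =
  1+n≰n (maximal (a ℤ.- + 1) (suc m) (Run-extendˡ {n} {a} cov run))

∣x-x%ℕd : ∀ x d .⦃ _ : NonZero d ⦄ → + d ∣ℤ x ℤ.- + (x %ℕ d)
∣x-x%ℕd x d = ℤ∣.divides (x /ℕ d) (begin
  x ℤ.- + (x %ℕ d)                                    ≡⟨ cong (ℤ._- + (x %ℕ d)) (a≡a%ℕn+[a/ℕn]*n x d) ⟩
  + (x %ℕ d) ℤ.+ (x /ℕ d) ℤ.* + d ℤ.- + (x %ℕ d)     ≡⟨ r+t-r≡t (+ (x %ℕ d)) ((x /ℕ d) ℤ.* + d) ⟩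
  (x /ℕ d) ℤ.* + d                                    ∎)
  where
  open ≡-Reasoning
  r+t-r≡t : ∀ r t → r ℤ.+ t ℤ.- r ≡ t
  r+t-r≡t = solve-∀

∣+⇒∣-[-%ℕ] : ∀ a y d .⦃ _ : NonZero d ⦄ → + d ∣ℤ a ℤ.+ y →
             + d ∣ℤ y ℤ.- + ((ℤ.- a) %ℕ d)
∣+⇒∣-[-%ℕ] a y d d∣a+y =
  subst (+ d ∣ℤ_) (telescope a y (+ ((ℤ.- a) %ℕ d)))
    (ℤ∣.∣m∣n⇒∣m+n d∣a+y (∣x-x%ℕd (ℤ.- a) d))
  where
  telescope : ∀ a y r → a ℤ.+ y ℤ.+ (ℤ.- a ℤ.- r) ≡ y ℤ.- r
  telescope = solve-∀

[-%ℕ]≡0⇒∣ : ∀ a d .⦃ _ : NonZero d ⦄ → (ℤ.- a) %ℕ d ≡ 0 → + d ∣ℤ a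
[-%ℕ]≡0⇒∣ a d r≡0 = subst (+ d ∣ℤ_) neg-neg-a-0≡a (ℤ∣.∣m⇒∣-m d∣-a-0)
  where
  d∣-a-0 : + d ∣ℤ ℤ.- a ℤ.- + 0
  d∣-a-0 = subst (λ r → + d ∣ℤ ℤ.- a ℤ.- + r) r≡0 (∣x-x%ℕd (ℤ.- a) d)
  neg-neg-a-0≡a : ℤ.- (ℤ.- a ℤ.- + 0) ≡ a
  neg-neg-a-0≡a = trans (cong ℤ.-_ (ℤ.+-identityʳ (ℤ.- a))) (ℤ.neg-involutive a)

-- p 0 = 0 is no modulus, so index 0 gets the junk value 0.
negResidue : ℤ → ℕ → ℕ
negResidue a zero    = 0
negResidue a (suc i) = _%ℕ_ (ℤ.- a) (p (suc i)) ⦃ p-nonZero i ⦄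

coveringStart⇒residues : ∀ {n m a} → IsOmega n m → Run n a m →
  (∀ i → 2 ≤ i → i ≤ n → 1 ≤ negResidue a i × negResidue a i < p i) ×
  CoveredByResidues n (negResidue a) m
coveringStart⇒residues {n} {m} {a} ω run = inRange , covered
  where
  inRange : ∀ i → 2 ≤ i → i ≤ n → 1 ≤ negResidue a i × negResidue a i < p i
  inRange (suc i) 2≤i i≤n with negResidue a (suc i) in r≡
  ... | zero  = contradiction
    (suc i , 2≤i , i≤n , ℤ∣.∣⇒∣ᵤ ([-%ℕ]≡0⇒∣ a (p (suc i)) ⦃ p-nonZero i ⦄ r≡))
    (maximalRun⇒¬Covered {n} {m} {a} ω run)
  ... | suc _ = s≤s z≤n , subst (_< p (suc i)) r≡ (n%ℕd<d (ℤ.- a) (p (suc i)) ⦃ p-nonZero i ⦄)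
  covered : CoveredByResidues n (negResidue a) m
  covered q 1≤q q≤m with run q 1≤q q≤m
  ... | suc i , 2≤i , i≤n , p∣a+q = suc i , 2≤i , i≤n ,
    ℤ∣.∣⇒∣ᵤ (∣+⇒∣-[-%ℕ] a (+ q) (p (suc i)) ⦃ p-nonZero i ⦄ (ℤ∣.∣ᵤ⇒∣ p∣a+q))

residues⇒coveringStart : ∀ {n m} r → CoveredByResidues n r m → ∃ λ a → Run n a m
residues⇒coveringStart {n} r cov with chineseRemainder p ∏p-coprime-p (λ i → ℤ.- + r i) n
... | a , a≡-r = a , run
  where
  run : Run n a _
  run q 1≤q q≤m with cov q 1≤q q≤m
  ... | i , 2≤i , i≤n , p∣q-r = i , 2≤i , i≤n ,
    ℤ∣.∣⇒∣ᵤ (subst (+ p i ∣ℤ_) (telescope a (+ r i) (+ q))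
      (ℤ∣.∣m∣n⇒∣m+n (a≡-r i (<⇒≤ 2≤i) i≤n) (ℤ∣.∣ᵤ⇒∣ p∣q-r)))
    where
    telescope : ∀ a r q → a ℤ.- ℤ.- r ℤ.+ (q ℤ.- r) ≡ a ℤ.+ q
    telescope = solve-∀

proposition1p9 : (n m : ℕ) → 1 < n → IsOmega n m →
    ((∃ λ (a : ℤ) → ∀ q → 1 ≤ q → q ≤ m →
    ∃ λ i → 2 ≤ i × i ≤ n × (+ (p i)) ℤD.∣ (a ℤ.+ + q))
    ⇔
    (∃ λ (a : ℕ → ℕ) → (∀ i → 2 ≤ i → i ≤ n → 1 ≤ a i × a i < p i) ×
    (∀ q → 1 ≤ q → q ≤ m →
    ∃ λ i → 2 ≤ i × i ≤ n × (+ (p i)) ℤD.∣ (+ q ℤ.- + (a i)))))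
proposition1p9 n m _ ω = mk⇔
  (λ (a , run) → negResidue a , coveringStart⇒residues {n} {m} {a} ω run)
  (λ (r , _ , cov) → residues⇒coveringStart r cov)
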